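{- Let $S\subseteq\mathbb R$ with $0\in S$. Then $\mathrm{L}\text{ - }\mathrm{ESO}_S[+,\times,\le]\equiv\mathrm{FO}$ with respect to $\mathbb R$-structures over function-free vocabularies: for every finite relational vocabulary $\tau$, every sentence of $\mathrm{L}\text{ - }\mathrm{ESO}_S[+,\times,\le]$ of vocabulary $\tau$ is satisfied by exactly the same $\mathbb R$-structures of vocabulary $\tau$ as some first-order sentence of vocabulary $\tau$, and conversely.
   Context: An $\mathbb R$-structure of a finite relational vocabulary $\tau$ (no function symbols) is a finite $\tau$-structure with nonempty domain $A$ together with the real numbers as a second sort; first-order logic $\mathrm{FO}$ is interpreted over the finite $\tau$-structure. $\mathrm{L}\text{ - }\mathrm{ESO}_S[+,\times,\le]$ has numerical terms $i::=f(\vec x)\mid i\times i\mid i+i$ with $f$ a function variable (no constants) and formulae $\phi::=x=y\mid\neg x=y\mid i\le j\mid R(\vec x)\mid\neg R(\vec x)\mid\phi\wedge\phi\mid\phi\vee\phi\mid\exists x\phi\mid\forall x\phi\mid\exists f\phi$ (no negated numerical atoms); first-order variables range over $A$, terms use real arithmetic, and $\exists f\phi$ holds iff $\phi$ holds for some interpretation of $f$ as a function $A^{\mathrm{ar}(f)}\to S$. -}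

module Defs where

open import Level using (0ℓ)
open import Data.Nat using (ℕ; zero; suc)
open import Data.Fin using (Fin; zero; suc)
open import Data.Vec using (Vec; map)
open import Data.List using (List; []; _∷_; length; lookup)
open import Data.Bool using (Bool; true)
open import Data.Product using (Σ; ∃; _×_; _,_)
open import Data.Sum using (_⊎_)
open import Relation.Nullary using (¬_)
open import Relation.Binary.PropositionalEquality using (_≡_)
open import Relation.Binary.Structures using (IsTotalOrder)
open import Algebra.Structures using (IsCommutativeRing)
open import Function.Bundles using (_⇔_)

-- The real numbers: a complete ordered field (unique up to isomorphism).

record RealNumbers : Set₁ where
  field
    Carrier : Set
    _+_ _*_ : Carrier → Carrier → Carrier
    -_      : Carrier → Carrier
    0# 1#   : Carrier
    _≤_     : Carrier → Carrier → Set
    isCommutativeRing : IsCommutativeRing _≡_ _+_ _*_ -_ 0# 1#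
    0≢1     : ¬ (0# ≡ 1#)
    inverse : ∀ x → ¬ (x ≡ 0#) → Σ Carrier (λ y → (x * y) ≡ 1#)
    isTotalOrder : IsTotalOrder _≡_ _≤_
    +-mono-≤ : ∀ x y z → x ≤ y → (x + z) ≤ (y + z)
    *-nonneg : ∀ x y → 0# ≤ x → 0# ≤ y → 0# ≤ (x * y)
    complete : (P : Carrier → Set) → Σ Carrier P →
               Σ Carrier (λ b → ∀ x → P x → x ≤ b) →
               Σ Carrier (λ s → (∀ x → P x → x ≤ s) ×
                                (∀ b → (∀ x → P x → x ≤ b) → s ≤ b))

record Vocabulary : Set where
  field
    nrel  : ℕ
    arity : Fin nrel → ℕ
open Vocabulary public

-- A finite τ-structure with nonempty domain Fin (suc size-1).
-- (The real sort is fixed and plays no role for relational vocabularies.)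
record Structure (τ : Vocabulary) : Set where
  field
    size-1 : ℕ
    interp : (R : Fin (nrel τ)) → Vec (Fin (suc size-1)) (arity τ R) → Bool
open Structure public

Dom : ∀ {τ} → Structure τ → Set
Dom 𝔄 = Fin (suc (size-1 𝔄))

data FO (τ : Vocabulary) : ℕ → Set where
  eq   : ∀ {m} → Fin m → Fin m → FO τ m
  rel  : ∀ {m} (R : Fin (nrel τ)) → Vec (Fin m) (arity τ R) → FO τ m
  not  : ∀ {m} → FO τ m → FO τ m
  and  : ∀ {m} → FO τ m → FO τ m → FO τ m
  or   : ∀ {m} → FO τ m → FO τ m → FO τ m
  ex   : ∀ {m} → FO τ (suc m) → FO τ m
  all  : ∀ {m} → FO τ (suc m) → FO τ m

extEnv : ∀ {m} {D : Set} → D → (Fin m → D) → Fin (suc m) → D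
extEnv d s zero    = d
extEnv d s (suc i) = s i

⟦_⟧FO : ∀ {τ m} → FO τ m → (𝔄 : Structure τ) → (Fin m → Dom 𝔄) → Set
⟦ eq x y ⟧FO 𝔄 s   = s x ≡ s y
⟦ rel R xs ⟧FO 𝔄 s = interp 𝔄 R (map s xs) ≡ true
⟦ not φ ⟧FO 𝔄 s    = ¬ (⟦ φ ⟧FO 𝔄 s)
⟦ and φ ψ ⟧FO 𝔄 s  = ⟦ φ ⟧FO 𝔄 s × ⟦ ψ ⟧FO 𝔄 s
⟦ or φ ψ ⟧FO 𝔄 s   = ⟦ φ ⟧FO 𝔄 s ⊎ ⟦ ψ ⟧FO 𝔄 s
⟦ ex φ ⟧FO 𝔄 s     = Σ (Dom 𝔄) (λ d → ⟦ φ ⟧FO 𝔄 (extEnv d s))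
⟦ all φ ⟧FO 𝔄 s    = ∀ d → ⟦ φ ⟧FO 𝔄 (extEnv d s)

FOSentence : Vocabulary → Set
FOSentence τ = FO τ 0

noVars : {D : Set} → Fin 0 → D
noVars ()

_⊨FO_ : ∀ {τ} → Structure τ → FOSentence τ → Set
𝔄 ⊨FO φ = ⟦ φ ⟧FO 𝔄 noVars

-- L-ESO_S[+,×,≤]
-- Γ : list of arities of the (existentially quantified) function variables,
-- m : number of free first-order variables.

data Term (Γ : List ℕ) (m : ℕ) : Set where
  app : (f : Fin (length Γ)) → Vec (Fin m) (lookup Γ f) → Term Γ m
  _⊗_ : Term Γ m → Term Γ m → Term Γ m
  _⊕_ : Term Γ m → Term Γ m → Term Γ m

data LESO (τ : Vocabulary) : List ℕ → ℕ → Set where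
  eq    : ∀ {Γ m} → Fin m → Fin m → LESO τ Γ m
  neq   : ∀ {Γ m} → Fin m → Fin m → LESO τ Γ m
  le    : ∀ {Γ m} → Term Γ m → Term Γ m → LESO τ Γ m
  rel   : ∀ {Γ m} (R : Fin (nrel τ)) → Vec (Fin m) (arity τ R) → LESO τ Γ m
  nrelat : ∀ {Γ m} (R : Fin (nrel τ)) → Vec (Fin m) (arity τ R) → LESO τ Γ m
  and   : ∀ {Γ m} → LESO τ Γ m → LESO τ Γ m → LESO τ Γ m
  or    : ∀ {Γ m} → LESO τ Γ m → LESO τ Γ m → LESO τ Γ m
  ex    : ∀ {Γ m} → LESO τ Γ (suc m) → LESO τ Γ m
  all   : ∀ {Γ m} → LESO τ Γ (suc m) → LESO τ Γ m
  exfun : ∀ {Γ m} (k : ℕ) → LESO τ (k ∷ Γ) m → LESO τ Γ m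

module ESOSemantics (ℝ : RealNumbers) (S : RealNumbers.Carrier ℝ → Set) where
  open RealNumbers ℝ

  FunEnv : Set → List ℕ → Set
  FunEnv D Γ = (f : Fin (length Γ)) → Vec D (lookup Γ f) → Carrier

  extFun : ∀ {D Γ k} → (Vec D k → Carrier) → FunEnv D Γ → FunEnv D (k ∷ Γ)
  extFun g F zero    = g
  extFun g F (suc f) = F f

  evalTerm : ∀ {D Γ m} → FunEnv D Γ → (Fin m → D) → Term Γ m → Carrier
  evalTerm F s (app f xs) = F f (map s xs)
  evalTerm F s (i ⊗ j)    = evalTerm F s i * evalTerm F s j
  evalTerm F s (i ⊕ j)    = evalTerm F s i + evalTerm F s j

  ⟦_⟧ : ∀ {τ Γ m} → LESO τ Γ m → (𝔄 : Structure τ) →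
        FunEnv (Dom 𝔄) Γ → (Fin m → Dom 𝔄) → Set
  ⟦ eq x y ⟧ 𝔄 F s    = s x ≡ s y
  ⟦ neq x y ⟧ 𝔄 F s   = ¬ (s x ≡ s y)
  ⟦ le i j ⟧ 𝔄 F s    = evalTerm F s i ≤ evalTerm F s j
  ⟦ rel R xs ⟧ 𝔄 F s  = interp 𝔄 R (map s xs) ≡ true
  ⟦ nrelat R xs ⟧ 𝔄 F s = ¬ (interp 𝔄 R (map s xs) ≡ true)
  ⟦ and φ ψ ⟧ 𝔄 F s   = ⟦ φ ⟧ 𝔄 F s × ⟦ ψ ⟧ 𝔄 F s
  ⟦ or φ ψ ⟧ 𝔄 F s    = ⟦ φ ⟧ 𝔄 F s ⊎ ⟦ ψ ⟧ 𝔄 F s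
  ⟦ ex φ ⟧ 𝔄 F s      = Σ (Dom 𝔄) (λ d → ⟦ φ ⟧ 𝔄 F (extEnv d s))
  ⟦ all φ ⟧ 𝔄 F s     = ∀ d → ⟦ φ ⟧ 𝔄 F (extEnv d s)
  ⟦ exfun k φ ⟧ 𝔄 F s =
    Σ (Vec (Dom 𝔄) k → Carrier) (λ g → (∀ v → S (g v)) × ⟦ φ ⟧ 𝔄 (extFun g F) s)

  noFuns : {D : Set} → FunEnv D []
  noFuns ()

  _⊨_ : ∀ {τ} → Structure τ → LESO τ [] 0 → Set
  𝔄 ⊨ φ = ⟦ φ ⟧ 𝔄 noFuns noVars

LESOSentence : Vocabulary → Set
LESOSentence τ = LESO τ [] 0

SameModels : (ℝ : RealNumbers) (S : RealNumbers.Carrier ℝ → Set) (τ : Vocabulary) →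
             LESOSentence τ → FOSentence τ → Set
SameModels ℝ S τ φ ψ = (𝔄 : Structure τ) → (𝔄 ⊨ φ) ⇔ (𝔄 ⊨FO ψ)
  where open ESOSemantics ℝ S

-- A sentence of L-ESO_S[+,×,≤] has numerical atoms only positively, so interpreting every
-- function variable as the constant 0 ∈ S makes all its atoms i ≤ j true (both sides are 0);
-- hence it is equivalent to its first-order skeleton, with numerical atoms replaced by "true"
-- and function quantifiers dropped. Conversely, a first-order sentence is equivalent to its
-- negation normal form, which is an L-ESO sentence without numerical atoms; the De Morgan
-- laws this needs hold constructively because first-order truth in a finite structure is
-- decidable.
module Submission where

open import Defs
open import Data.Product using (Σ; _×_; _,_; proj₁; proj₂)
open import Data.Fin using (Fin; zero; suc)
open import Data.Fin.Properties as Fin using (any?; all?; ¬∀⟶∃¬)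
open import Data.Bool using (true)
import Data.Bool.Properties as Bool
open import Data.List using (_∷_)
open import Data.Sum using (inj₁; inj₂)
open import Relation.Nullary using (¬_; Dec; yes; no)
open import Relation.Nullary.Decidable using (¬?; _×-dec_; _⊎-dec_; decidable-stable)
open import Relation.Binary.PropositionalEquality using (_≡_; refl; sym; trans; cong₂; subst₂)
open import Relation.Binary.Structures using (IsTotalOrder)
open import Algebra.Structures using (IsCommutativeRing)
open import Function.Bundles using (mk⇔)

FO-decidable : ∀ {τ m} (φ : FO τ m) (𝔄 : Structure τ) (s : Fin m → Dom 𝔄) →
               Dec (⟦ φ ⟧FO 𝔄 s)
FO-decidable (eq x y)   𝔄 s = s x Fin.≟ s y
FO-decidable (rel R xs) 𝔄 s = _ Bool.≟ true
FO-decidable (not φ)    𝔄 s = ¬? (FO-decidable φ 𝔄 s)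
FO-decidable (and φ ψ)  𝔄 s = FO-decidable φ 𝔄 s ×-dec FO-decidable ψ 𝔄 s
FO-decidable (or φ ψ)   𝔄 s = FO-decidable φ 𝔄 s ⊎-dec FO-decidable ψ 𝔄 s
FO-decidable (ex φ)     𝔄 s = any? (λ d → FO-decidable φ 𝔄 (extEnv d s))
FO-decidable (all φ)    𝔄 s = all? (λ d → FO-decidable φ 𝔄 (extEnv d s))

nnf nnf¬ : ∀ {τ Γ m} → FO τ m → LESO τ Γ m
nnf (eq x y)   = eq x y
nnf (rel R xs) = rel R xs
nnf (not φ)    = nnf¬ φ
nnf (and φ ψ)  = and (nnf φ) (nnf ψ)
nnf (or φ ψ)   = or (nnf φ) (nnf ψ)
nnf (ex φ)     = ex (nnf φ)
nnf (all φ)    = all (nnf φ)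
nnf¬ (eq x y)   = neq x y
nnf¬ (rel R xs) = nrelat R xs
nnf¬ (not φ)    = nnf φ
nnf¬ (and φ ψ)  = or (nnf¬ φ) (nnf¬ ψ)
nnf¬ (or φ ψ)   = and (nnf¬ φ) (nnf¬ ψ)
nnf¬ (ex φ)     = all (nnf¬ φ)
nnf¬ (all φ)    = ex (nnf¬ φ)

-- FO has no truth constant; this sentence is valid since domains are nonempty.
⊤ : ∀ {τ m} → FO τ m
⊤ = ex (eq zero zero)

dropNumeric : ∀ {τ Γ m} → LESO τ Γ m → FO τ m
dropNumeric (eq x y)      = eq x y
dropNumeric (neq x y)     = not (eq x y)
dropNumeric (le i j)      = ⊤
dropNumeric (rel R xs)    = rel R xs
dropNumeric (nrelat R xs) = not (rel R xs)
dropNumeric (and φ ψ)     = and (dropNumeric φ) (dropNumeric ψ)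
dropNumeric (or φ ψ)      = or (dropNumeric φ) (dropNumeric ψ)
dropNumeric (ex φ)        = ex (dropNumeric φ)
dropNumeric (all φ)       = all (dropNumeric φ)
dropNumeric (exfun k φ)   = dropNumeric φ

module _ (ℝ : RealNumbers) (S : RealNumbers.Carrier ℝ → Set) where
  open RealNumbers ℝ
  open ESOSemantics ℝ S
  open IsCommutativeRing isCommutativeRing using (zeroˡ; +-identityˡ)

  module _ {τ Γ} (𝔄 : Structure τ) (F : FunEnv (Dom 𝔄) Γ) where

    nnf-sound    : ∀ {m} (φ : FO τ m) s → ⟦ nnf {Γ = Γ} φ ⟧ 𝔄 F s → ⟦ φ ⟧FO 𝔄 s
    nnf-complete : ∀ {m} (φ : FO τ m) s → ⟦ φ ⟧FO 𝔄 s → ⟦ nnf {Γ = Γ} φ ⟧ 𝔄 F s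
    nnf¬-sound    : ∀ {m} (φ : FO τ m) s → ⟦ nnf¬ {Γ = Γ} φ ⟧ 𝔄 F s → ¬ ⟦ φ ⟧FO 𝔄 s
    nnf¬-complete : ∀ {m} (φ : FO τ m) s → ¬ ⟦ φ ⟧FO 𝔄 s → ⟦ nnf¬ {Γ = Γ} φ ⟧ 𝔄 F s

    nnf-sound (eq x y)   s h              = h
    nnf-sound (rel R xs) s h              = h
    nnf-sound (not φ)    s h              = nnf¬-sound φ s h
    nnf-sound (and φ ψ)  s (a , b)        = nnf-sound φ s a , nnf-sound ψ s b
    nnf-sound (or φ ψ)   s (inj₁ a)       = inj₁ (nnf-sound φ s a)
    nnf-sound (or φ ψ)   s (inj₂ b)       = inj₂ (nnf-sound ψ s b)
    nnf-sound (ex φ)     s (d , h)        = d , nnf-sound φ (extEnv d s) h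
    nnf-sound (all φ)    s h d            = nnf-sound φ (extEnv d s) (h d)

    nnf-complete (eq x y)   s h           = h
    nnf-complete (rel R xs) s h           = h
    nnf-complete (not φ)    s h           = nnf¬-complete φ s h
    nnf-complete (and φ ψ)  s (a , b)     = nnf-complete φ s a , nnf-complete ψ s b
    nnf-complete (or φ ψ)   s (inj₁ a)    = inj₁ (nnf-complete φ s a)
    nnf-complete (or φ ψ)   s (inj₂ b)    = inj₂ (nnf-complete ψ s b)
    nnf-complete (ex φ)     s (d , h)     = d , nnf-complete φ (extEnv d s) h
    nnf-complete (all φ)    s h d         = nnf-complete φ (extEnv d s) (h d)

    nnf¬-sound (eq x y)   s h             = h
    nnf¬-sound (rel R xs) s h             = h
    nnf¬-sound (not φ)    s h ¬φ          = ¬φ (nnf-sound φ s h)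
    nnf¬-sound (and φ ψ)  s (inj₁ a) φ∧ψ  = nnf¬-sound φ s a (proj₁ φ∧ψ)
    nnf¬-sound (and φ ψ)  s (inj₂ b) φ∧ψ  = nnf¬-sound ψ s b (proj₂ φ∧ψ)
    nnf¬-sound (or φ ψ)   s (a , b) (inj₁ x) = nnf¬-sound φ s a x
    nnf¬-sound (or φ ψ)   s (a , b) (inj₂ y) = nnf¬-sound ψ s b y
    nnf¬-sound (ex φ)     s h (d , x)     = nnf¬-sound φ (extEnv d s) (h d) x
    nnf¬-sound (all φ)    s (d , h) x     = nnf¬-sound φ (extEnv d s) h (x d)

    nnf¬-complete (eq x y)   s h = h
    nnf¬-complete (rel R xs) s h = h
    nnf¬-complete (not φ)    s h =
      nnf-complete φ s (decidable-stable (FO-decidable φ 𝔄 s) h)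
    nnf¬-complete (and φ ψ)  s h with FO-decidable φ 𝔄 s
    ... | yes a = inj₂ (nnf¬-complete ψ s (λ b → h (a , b)))
    ... | no ¬a = inj₁ (nnf¬-complete φ s ¬a)
    nnf¬-complete (or φ ψ)   s h =
      nnf¬-complete φ s (λ a → h (inj₁ a)) , nnf¬-complete ψ s (λ b → h (inj₂ b))
    nnf¬-complete (ex φ)     s h d = nnf¬-complete φ (extEnv d s) (λ x → h (d , x))
    nnf¬-complete (all φ)    s h =
      let d , ¬φd = ¬∀⟶∃¬ _ _ (λ d → FO-decidable φ 𝔄 (extEnv d s)) h
      in d , nnf¬-complete φ (extEnv d s) ¬φd

  IsZeroFunEnv : ∀ {D} Γ → FunEnv D Γ → Set
  IsZeroFunEnv Γ F = ∀ f v → F f v ≡ 0#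

  extFun-zero : ∀ {D Γ k} {F : FunEnv D Γ} → IsZeroFunEnv Γ F →
                IsZeroFunEnv (k ∷ Γ) (extFun (λ _ → 0#) F)
  extFun-zero F≡0 zero    v = refl
  extFun-zero F≡0 (suc f) v = F≡0 f v

  evalTerm-zero : ∀ {D Γ m} {F : FunEnv D Γ} → IsZeroFunEnv Γ F →
                  (s : Fin m → D) (t : Term Γ m) → evalTerm F s t ≡ 0#
  evalTerm-zero F≡0 s (app f xs) = F≡0 f _
  evalTerm-zero F≡0 s (i ⊗ j) =
    trans (cong₂ _*_ (evalTerm-zero F≡0 s i) (evalTerm-zero F≡0 s j)) (zeroˡ 0#)
  evalTerm-zero F≡0 s (i ⊕ j) =
    trans (cong₂ _+_ (evalTerm-zero F≡0 s i) (evalTerm-zero F≡0 s j)) (+-identityˡ 0#)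

  module _ {τ} (𝔄 : Structure τ) where

    dropNumeric-sound : ∀ {Γ m} (φ : LESO τ Γ m) F s →
                        ⟦ φ ⟧ 𝔄 F s → ⟦ dropNumeric φ ⟧FO 𝔄 s
    dropNumeric-sound (eq x y)      F s h             = h
    dropNumeric-sound (neq x y)     F s h             = h
    dropNumeric-sound (le i j)      F s h             = zero , refl
    dropNumeric-sound (rel R xs)    F s h             = h
    dropNumeric-sound (nrelat R xs) F s h             = h
    dropNumeric-sound (and φ ψ)     F s (a , b)       =
      dropNumeric-sound φ F s a , dropNumeric-sound ψ F s b
    dropNumeric-sound (or φ ψ)      F s (inj₁ a)      = inj₁ (dropNumeric-sound φ F s a)
    dropNumeric-sound (or φ ψ)      F s (inj₂ b)      = inj₂ (dropNumeric-sound ψ F s b)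
    dropNumeric-sound (ex φ)        F s (d , h)       = d , dropNumeric-sound φ F (extEnv d s) h
    dropNumeric-sound (all φ)       F s h d           = dropNumeric-sound φ F (extEnv d s) (h d)
    dropNumeric-sound (exfun k φ)   F s (g , _ , h)   = dropNumeric-sound φ (extFun g F) s h

    dropNumeric-complete : S 0# → ∀ {Γ m} (φ : LESO τ Γ m) F s → IsZeroFunEnv Γ F →
                           ⟦ dropNumeric φ ⟧FO 𝔄 s → ⟦ φ ⟧ 𝔄 F s
    dropNumeric-complete S0 (eq x y)      F s F≡0 h = h
    dropNumeric-complete S0 (neq x y)     F s F≡0 h = h
    dropNumeric-complete S0 (le i j)      F s F≡0 h =
      subst₂ _≤_ (sym (evalTerm-zero F≡0 s i)) (sym (evalTerm-zero F≡0 s j))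
             (IsTotalOrder.refl isTotalOrder)
    dropNumeric-complete S0 (rel R xs)    F s F≡0 h = h
    dropNumeric-complete S0 (nrelat R xs) F s F≡0 h = h
    dropNumeric-complete S0 (and φ ψ)     F s F≡0 (a , b) =
      dropNumeric-complete S0 φ F s F≡0 a , dropNumeric-complete S0 ψ F s F≡0 b
    dropNumeric-complete S0 (or φ ψ)      F s F≡0 (inj₁ a) =
      inj₁ (dropNumeric-complete S0 φ F s F≡0 a)
    dropNumeric-complete S0 (or φ ψ)      F s F≡0 (inj₂ b) =
      inj₂ (dropNumeric-complete S0 ψ F s F≡0 b)
    dropNumeric-complete S0 (ex φ)        F s F≡0 (d , h) =
      d , dropNumeric-complete S0 φ F (extEnv d s) F≡0 h
    dropNumeric-complete S0 (all φ)       F s F≡0 h d =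
      dropNumeric-complete S0 φ F (extEnv d s) F≡0 (h d)
    dropNumeric-complete S0 (exfun k φ)   F s F≡0 h =
      (λ _ → 0#) , (λ _ → S0) , dropNumeric-complete S0 φ _ s (extFun-zero F≡0) h

proposition5p6 : (ℝ : RealNumbers) (S : RealNumbers.Carrier ℝ → Set) →
                 S (RealNumbers.0# ℝ) →
                 (τ : Vocabulary) →
                 ((φ : LESOSentence τ) → Σ (FOSentence τ) (λ ψ → SameModels ℝ S τ φ ψ)) ×
                 ((ψ : FOSentence τ) → Σ (LESOSentence τ) (λ φ → SameModels ℝ S τ φ ψ))
proposition5p6 ℝ S S0 τ = LESO→FO , FO→LESO
  where
  open ESOSemantics ℝ S using (noFuns)

  LESO→FO : (φ : LESOSentence τ) → Σ (FOSentence τ) (λ ψ → SameModels ℝ S τ φ ψ)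
  LESO→FO φ = dropNumeric φ , λ 𝔄 →
    mk⇔ (dropNumeric-sound ℝ S 𝔄 φ noFuns noVars)
        (dropNumeric-complete ℝ S 𝔄 S0 φ noFuns noVars (λ ()))

  FO→LESO : (ψ : FOSentence τ) → Σ (LESOSentence τ) (λ φ → SameModels ℝ S τ φ ψ)
  FO→LESO ψ = nnf ψ , λ 𝔄 →
    mk⇔ (nnf-sound ℝ S 𝔄 noFuns ψ noVars) (nnf-complete ℝ S 𝔄 noFuns ψ noVars)
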